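{- Let $k\ge 2$ and let $G$ be a bridgeless graph with girth at least $2k-1$. If $G$ is $2$-simultaneous edge colorable, then $|E(G)|\ge k\,\chi'(G)$.
   Context: All graphs are finite and simple; $[l]=\{1,\ldots,l\}$. "Bridgeless" means $2$-edge-connected. $\chi'(G)$ is the edge chromatic number. A $2$-simultaneous edge coloring of $G$ is a pair $(c_1,c_2)$ of proper edge colorings $c_i:E(G)\to[l]$ with a common color set such that for every vertex $v$ the sets of colors on edges incident to $v$ are the same under $c_1$ and $c_2$, and $c_1(e)\ne c_2(e)$ for every edge $e$; $G$ is $2$-simultaneous edge colorable if such a pair exists for some $l$. -}

module Defs where

open import Data.Nat using (ℕ; zero; suc; _≤_)
open import Data.Fin using (Fin; zero; suc; inject₁; fromℕ)
open import Data.Product using (Σ; _×_; _,_; ∃)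
open import Data.Sum using (_⊎_)
open import Relation.Binary.PropositionalEquality using (_≡_; _≢_)
open import Function.Bundles using (_⇔_)
open import Function.Definitions using (Injective)
open import Data.Unit using (⊤)

record Graph : Set where
  field
    n     : ℕ
    m     : ℕ
    src   : Fin m → Fin n
    tgt   : Fin m → Fin n
    loopless : ∀ e → src e ≢ tgt e
    simple   : ∀ e e' →
      ((src e ≡ src e' × tgt e ≡ tgt e') ⊎ (src e ≡ tgt e' × tgt e ≡ src e')) →
      e ≡ e'

module _ (G : Graph) where
  open Graph G

  V : Set
  V = Fin n

  E : Set
  E = Fin m

  numEdges : ℕ
  numEdges = m

  Incident : V → E → Set
  Incident v e = (src e ≡ v) ⊎ (tgt e ≡ v)

  Joins : E → V → V → Set
  Joins e u v = (src e ≡ u × tgt e ≡ v) ⊎ (src e ≡ v × tgt e ≡ u)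

  Adj : V → V → Set
  Adj u v = Σ E λ e → Joins e u v

  data Reach (ok : E → Set) : V → V → Set where
    here : ∀ {v} → Reach ok v v
    step : ∀ {u w v} (e : E) → ok e → Joins e u w → Reach ok w v → Reach ok u v

  -- Bridgeless = 2-edge-connected: connected, and remains connected after
  -- deleting any single edge.
  Bridgeless : Set
  Bridgeless = (∀ u v → Reach (λ _ → ⊤) u v)
             × (∀ (e₀ : E) → ∀ u v → Reach (λ e → e ≢ e₀) u v)

  record Cycle (L : ℕ) : Set where
    field
      p      : ℕ
      len    : L ≡ suc p
      three  : 3 ≤ L
      vert   : Fin (suc p) → V
      inj    : Injective _≡_ _≡_ vert
      path   : ∀ (i : Fin p) → Adj (vert (inject₁ i)) (vert (suc i))
      close  : Adj (vert (fromℕ p)) (vert zero)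

  -- girth ≥ g : every cycle has length at least g (acyclic graphs qualify)
  GirthAtLeast : ℕ → Set
  GirthAtLeast g = ∀ L → Cycle L → g ≤ L

  Proper : {l : ℕ} → (E → Fin l) → Set
  Proper c = ∀ e e' → e ≢ e' → Σ V (λ v → Incident v e × Incident v e') → c e ≢ c e'

  EdgeColorable : ℕ → Set
  EdgeColorable l = Σ (E → Fin l) Proper

  IsChromaticIndex : ℕ → Set
  IsChromaticIndex l = EdgeColorable l × (∀ l' → EdgeColorable l' → l ≤ l')

  ColorAt : {l : ℕ} → (E → Fin l) → V → Fin l → Set
  ColorAt c v x = Σ E λ e → Incident v e × c e ≡ x

  record SimColoring (l : ℕ) : Set where
    field
      c₁ c₂   : E → Fin l
      proper₁ : Proper c₁
      proper₂ : Proper c₂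
      sameSets : ∀ v x → ColorAt c₁ v x ⇔ ColorAt c₂ v x
      differ  : ∀ e → c₁ e ≢ c₂ e

  SimColorable : Set
  SimColorable = Σ ℕ SimColoring

-- Fix a color x of c₁ and an edge of that color. Walk away from it, alternately
-- along edges colored x by c₁ and by c₂: since both colorings see the same colors
-- at every vertex, the walk can always be continued, and since c₁ e ≢ c₂ e it never
-- turns back along the edge it arrived on. A non-backtracking walk that returned to a
-- vertex within fewer than 2k − 1 steps would close a cycle shorter than the girth,
-- so its first 2k − 1 edges are distinct; every other one has c₁-color x, so each
-- color class of c₁ has at least k edges. Renaming the colors actually used by c₁
-- therefore gives a proper coloring with at most |E(G)| / k colors.
module Submission where

open import Defs
open import Data.Nat using (ℕ; zero; suc; _≤_; _<_; _*_; _∸_; _+_; z≤n; s≤s)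
open import Data.Nat.Properties
open import Data.Fin as Fin using (Fin; toℕ; inject₁; fromℕ; combine; remQuot)
open import Data.Fin.Properties
  using (toℕ-injective; toℕ<n; toℕ-inject₁; toℕ-fromℕ; injective⇒≤; combine-remQuot)
open import Data.Bool using (Bool; true; false; not)
open import Data.Product using (Σ; Σ-syntax; ∃; _×_; _,_; proj₁; proj₂; uncurry)
open import Data.Sum using (_⊎_; inj₁; inj₂)
open import Data.Empty using (⊥-elim)
open import Data.List using (List; _∷_; length; lookup; tabulate; deduplicate)
open import Data.List.Membership.Propositional.Properties
  using (∈-tabulate⁺; ∈-tabulate⁻; ∈-lookup; ∈-deduplicate⁺; ∈-deduplicate⁻)
import Data.List.Relation.Unary.All as All
open import Data.List.Relation.Unary.Any using (index)
open import Data.List.Relation.Unary.Any.Properties using (lookup-index)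
open import Data.List.Relation.Unary.AllPairs using (_∷_)
open import Data.List.Relation.Unary.Unique.Propositional using (Unique)
open import Data.List.Relation.Unary.Unique.DecPropositional.Properties using (deduplicate-!)
open import Function using (_∘_)
open import Function.Bundles using (Equivalence)
open import Function.Definitions using (Injective)
open import Relation.Binary.Definitions using (DecidableEquality; tri<; tri≈; tri>)
open import Relation.Binary.PropositionalEquality
open import Relation.Nullary using (¬_)

lookup-injective : ∀ {a} {A : Set a} {xs : List A} → Unique xs →
                   ∀ {i j} → lookup xs i ≡ lookup xs j → i ≡ j
lookup-injective (_    ∷ _)      {Fin.zero}  {Fin.zero}  _  = refl
lookup-injective (x∉xs ∷ _)      {Fin.zero}  {Fin.suc j} eq = ⊥-elim (All.lookup x∉xs (∈-lookup j) eq)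
lookup-injective (x∉xs ∷ _)      {Fin.suc i} {Fin.zero}  eq = ⊥-elim (All.lookup x∉xs (∈-lookup i) (sym eq))
lookup-injective (_    ∷ unique) {Fin.suc i} {Fin.suc j} eq = cong Fin.suc (lookup-injective unique eq)

remQuot-injective : ∀ {m} n {s t : Fin (m * n)} → remQuot {m} n s ≡ remQuot n t → s ≡ t
remQuot-injective {m} n {s} {t} eq = begin
  s                                 ≡⟨ combine-remQuot {m} n s ⟨
  uncurry combine (remQuot {m} n s) ≡⟨ cong (uncurry combine) eq ⟩
  uncurry combine (remQuot {m} n t) ≡⟨ combine-remQuot {m} n t ⟩
  t                                 ∎
  where open ≡-Reasoning

FiberAtLeast : ∀ {a} {A : Set a} {m} → ℕ → (Fin m → A) → Fin m → Set a
FiberAtLeast {m = m} k f e =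
  Σ[ g ∈ (Fin k → Fin m) ] Injective _≡_ _≡_ g × (∀ i → f (g i) ≡ f e)

module Image {a} {A : Set a} (_≟_ : DecidableEquality A) {m} (f : Fin m → A) where

  image : List A
  image = deduplicate _≟_ (tabulate f)

  index-in-image : Fin m → Fin (length image)
  index-in-image e = index (∈-deduplicate⁺ _≟_ (∈-tabulate⁺ e))

  lookup-index-in-image : ∀ e → f e ≡ lookup image (index-in-image e)
  lookup-index-in-image e = lookup-index (∈-deduplicate⁺ _≟_ (∈-tabulate⁺ e))

  index-in-image-reflects : ∀ {e e'} → index-in-image e ≡ index-in-image e' → f e ≡ f e'
  index-in-image-reflects {e} {e'} same = begin
    f e                              ≡⟨ lookup-index-in-image e ⟩
    lookup image (index-in-image e)  ≡⟨ cong (lookup image) same ⟩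
    lookup image (index-in-image e') ≡⟨ lookup-index-in-image e' ⟨
    f e'                             ∎
    where open ≡-Reasoning

  preimage : ∀ j → ∃ λ e → lookup image j ≡ f e
  preimage j = ∈-tabulate⁻ (∈-deduplicate⁻ _≟_ (tabulate f) (∈-lookup j))

  -- Choosing k points in the fiber over each value of f injects image × Fin k into Fin m.
  ∣image∣*k≤m : ∀ {k} → (∀ e → FiberAtLeast k f e) → length image * k ≤ m
  ∣image∣*k≤m {k} large = injective⇒≤ (remQuot-injective {length image} k ∘ spread-injective)
    where
    spread : Fin (length image) × Fin k → Fin m
    spread (j , i) = proj₁ (large (proj₁ (preimage j))) i

    f-spread : ∀ j i → f (spread (j , i)) ≡ lookup image j
    f-spread j i = trans (proj₂ (proj₂ (large (proj₁ (preimage j)))) i) (sym (proj₂ (preimage j)))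

    spread-injective : ∀ {p q} → spread p ≡ spread q → p ≡ q
    spread-injective {j , i} {j' , i'} eq
      with refl ← lookup-injective (deduplicate-! _≟_ (tabulate f))
                    (trans (sym (f-spread j i)) (trans (cong f eq) (f-spread j' i')))
      = cong (j ,_) (proj₁ (proj₂ (large (proj₁ (preimage j)))) eq)

parity : ℕ → Bool
parity zero    = false
parity (suc n) = not (parity n)

parity-even : ∀ n → parity (n * 2) ≡ false
parity-even zero    = refl
parity-even (suc n) = cong (not ∘ not) (parity-even n)

double<2*∸1 : ∀ {i k} → i < k → i * 2 < 2 * k ∸ 1
double<2*∸1 {i} {k} i<k = ∸-monoˡ-≤ 1 (subst (suc i * 2 ≤_) (*-comm k 2) (*-monoˡ-≤ 2 i<k))

module _ (G : Graph) where
  open Graph G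

  Joins-sym : ∀ {e u v} → Joins G e u v → Joins G e v u
  Joins-sym (inj₁ p) = inj₂ p
  Joins-sym (inj₂ p) = inj₁ p

  Joins-irrefl : ∀ {e u} → ¬ Joins G e u u
  Joins-irrefl {e} (inj₁ (p , q)) = loopless e (trans p (sym q))
  Joins-irrefl {e} (inj₂ (p , q)) = loopless e (trans p (sym q))

  Joins-unique : ∀ {e e' u v} → Joins G e u v → Joins G e' u v → e ≡ e'
  Joins-unique (inj₁ (p , q)) (inj₁ (r , s)) = simple _ _ (inj₁ (trans p (sym r) , trans q (sym s)))
  Joins-unique (inj₁ (p , q)) (inj₂ (r , s)) = simple _ _ (inj₂ (trans p (sym s) , trans q (sym r)))
  Joins-unique (inj₂ (p , q)) (inj₁ (r , s)) = simple _ _ (inj₂ (trans p (sym s) , trans q (sym r)))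
  Joins-unique (inj₂ (p , q)) (inj₂ (r , s)) = simple _ _ (inj₁ (trans p (sym r) , trans q (sym s)))

  Joins⇒Incident : ∀ {e u v} → Joins G e u v → Incident G u e
  Joins⇒Incident (inj₁ (p , _)) = inj₁ p
  Joins⇒Incident (inj₂ (_ , q)) = inj₂ q

  Incident⇒endpoint : ∀ {e u v z} → Joins G e u v → Incident G z e → z ≡ u ⊎ z ≡ v
  Incident⇒endpoint (inj₁ (p , q)) (inj₁ r) = inj₁ (trans (sym r) p)
  Incident⇒endpoint (inj₁ (p , q)) (inj₂ r) = inj₂ (trans (sym r) q)
  Incident⇒endpoint (inj₂ (p , q)) (inj₁ r) = inj₂ (trans (sym r) p)
  Incident⇒endpoint (inj₂ (p , q)) (inj₂ r) = inj₁ (trans (sym r) q)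

  opposite : ∀ {v e} → Incident G v e → ∃ λ w → Joins G e v w
  opposite (inj₁ p) = tgt _ , inj₁ (p , refl)
  opposite (inj₂ p) = src _ , inj₂ (refl , p)

  record Walk : Set where
    field
      vertex : ℕ → V G
      edge   : ℕ → E G
      joins  : ∀ n → Joins G (edge n) (vertex n) (vertex (suc n))

  NonBacktracking : Walk → Set
  NonBacktracking W = ∀ n → edge n ≢ edge (suc n)
    where open Walk W

  module _ (W : Walk) (non-backtracking : NonBacktracking W) where
    open Walk W

    closedSegment⇒Cycle : ∀ i p → 2 ≤ p →
      (∀ {a b} → a ≤ p → b ≤ p → vertex (i + a) ≡ vertex (i + b) → a ≡ b) →
      vertex (i + suc p) ≡ vertex i → Cycle G (suc p)
    closedSegment⇒Cycle i p 2≤p distinct closed = record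
      { p     = p
      ; len   = refl
      ; three = s≤s 2≤p
      ; vert  = λ a → vertex (i + toℕ a)
      ; inj   = λ {a} {b} eq → toℕ-injective (distinct (toℕ≤ a) (toℕ≤ b) eq)
      ; path  = λ a → edge (i + toℕ a) , path a
      ; close = edge (i + p) , close
      }
      where
      toℕ≤ : (a : Fin (suc p)) → toℕ a ≤ p
      toℕ≤ a = ≤-pred (toℕ<n a)

      path : ∀ a → Joins G (edge (i + toℕ a)) (vertex (i + toℕ (inject₁ a))) (vertex (i + suc (toℕ a)))
      path a rewrite toℕ-inject₁ a | +-suc i (toℕ a) = joins (i + toℕ a)

      close : Joins G (edge (i + p)) (vertex (i + toℕ (fromℕ p))) (vertex (i + 0))
      close rewrite toℕ-fromℕ p | +-identityʳ i | sym closed | +-suc i p = joins (i + p)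

    module _ {g} (girth : GirthAtLeast G g) where

      DistinctUpTo : ℕ → Set
      DistinctUpTo b = ∀ {i j} → i < j → j ≤ b → vertex i ≢ vertex j

      -- A return after one step is a loop, after two a backtrack, later a short cycle.
      no-short-return : ∀ i p → DistinctUpTo (i + p) → suc p < g → vertex (i + suc p) ≢ vertex i
      no-short-return i zero _ _ back =
        Joins-irrefl (subst (Joins G (edge i) (vertex i)) (trans (cong vertex (+-comm 1 i)) back) (joins i))
      no-short-return i (suc zero) _ _ back = non-backtracking i (Joins-unique (joins i) returning)
        where
        returning : Joins G (edge (suc i)) (vertex i) (vertex (suc i))
        returning = Joins-sym (subst (Joins G (edge (suc i)) (vertex (suc i)))
                                     (trans (cong vertex (+-comm 2 i)) back) (joins (suc i)))
      no-short-return i p@(suc (suc _)) distinct p<g back =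
        <⇒≱ p<g (girth _ (closedSegment⇒Cycle i p (s≤s (s≤s z≤n)) segment-distinct back))
        where
        segment-distinct : ∀ {a b} → a ≤ p → b ≤ p → vertex (i + a) ≡ vertex (i + b) → a ≡ b
        segment-distinct {a} {b} a≤p b≤p eq with <-cmp a b
        ... | tri< a<b _ _ = ⊥-elim (distinct (+-monoʳ-< i a<b) (+-monoʳ-≤ i b≤p) eq)
        ... | tri≈ _ a≡b _ = a≡b
        ... | tri> _ _ b<a = ⊥-elim (distinct (+-monoʳ-< i b<a) (+-monoʳ-≤ i a≤p) (sym eq))

      distinctUpTo : ∀ b → b < g → DistinctUpTo b
      distinctUpTo zero    _   ()          z≤n
      distinctUpTo (suc b) b<g {i} {j} i<j j≤b+1 with m≤n⇒m<n∨m≡n j≤b+1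
      ... | inj₁ j<b+1 = distinctUpTo b (<-trans (n<1+n b) b<g) i<j (≤-pred j<b+1)
      ... | inj₂ refl  = λ eq → no-short-return i (b ∸ i) earlier (≤-trans (s≤s (s≤s (m∸n≤m b i))) b<g)
                                   (trans (cong vertex i+[1+b∸i]≡1+b) (sym eq))
        where
        i+[b∸i]≡b : i + (b ∸ i) ≡ b
        i+[b∸i]≡b = m+[n∸m]≡n (≤-pred i<j)

        i+[1+b∸i]≡1+b : i + suc (b ∸ i) ≡ suc b
        i+[1+b∸i]≡1+b = trans (+-suc i (b ∸ i)) (cong suc i+[b∸i]≡b)

        earlier : DistinctUpTo (i + (b ∸ i))
        earlier = subst DistinctUpTo (sym i+[b∸i]≡b) (distinctUpTo b (<-trans (n<1+n b) b<g))

      vertex-distinct : ∀ {i j} → i < j → j < g → vertex i ≢ vertex j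
      vertex-distinct i<j j<g = distinctUpTo _ j<g i<j ≤-refl

      edge-distinct : ∀ {i j} → i < j → j < g → edge i ≢ edge j
      edge-distinct {i} {j} i<j j<g same
        with Incident⇒endpoint (joins i) (subst (Incident G (vertex j)) (sym same) (Joins⇒Incident (joins j)))
      ... | inj₁ j≡i = vertex-distinct i<j j<g (sym j≡i)
      ... | inj₂ j≡1+i with m≤n⇒m<n∨m≡n i<j
      ...   | inj₁ 1+i<j = vertex-distinct 1+i<j j<g (sym j≡1+i)
      ...   | inj₂ refl  = non-backtracking i same

      edge-injective : ∀ {i j} → i < g → j < g → edge i ≡ edge j → i ≡ j
      edge-injective {i} {j} i<g j<g same with <-cmp i j
      ... | tri< i<j _ _ = ⊥-elim (edge-distinct i<j j<g same)
      ... | tri≈ _ i≡j _ = i≡j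
      ... | tri> _ _ j<i = ⊥-elim (edge-distinct j<i i<g (sym same))

  module _ {l} (S : SimColoring G l) where
    open SimColoring S

    coloring : Bool → E G → Fin l
    coloring false = c₁
    coloring true  = c₂

    coloring-differ : ∀ b e → coloring b e ≢ coloring (not b) e
    coloring-differ false e = differ e
    coloring-differ true  e = differ e ∘ sym

    switch : ∀ b {v x} → ColorAt G (coloring b) v x → ColorAt G (coloring (not b)) v x
    switch false = Equivalence.to (sameSets _ _)
    switch true  = Equivalence.from (sameSets _ _)

    module Alternating (e₀ : E G) where

      Position : Bool → Set
      Position b = Σ (V G) λ v → ColorAt G (coloring b) v (c₁ e₀)

      advance : ∀ b → Position b → Position (not b)
      advance b (v , e , v∈e , color) =
        proj₁ (opposite v∈e) , switch b (e , Joins⇒Incident (Joins-sym (proj₂ (opposite v∈e))) , color)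

      position : ∀ n → Position (parity n)
      position zero    = src e₀ , e₀ , inj₁ refl , refl
      position (suc n) = advance (parity n) (position n)

      walk : Walk
      walk = record
        { vertex = λ n → proj₁ (position n)
        ; edge   = λ n → proj₁ (proj₂ (position n))
        ; joins  = λ n → proj₂ (opposite (proj₁ (proj₂ (proj₂ (position n)))))
        }
      open Walk walk

      edge-color : ∀ n → coloring (parity n) (edge n) ≡ c₁ e₀
      edge-color n = proj₂ (proj₂ (proj₂ (position n)))

      walk-non-backtracking : NonBacktracking walk
      walk-non-backtracking n same = coloring-differ (parity n) (edge n) (trans (edge-color n) (sym next))
        where
        next : coloring (not (parity n)) (edge n) ≡ c₁ e₀
        next = subst (λ e → coloring (not (parity n)) e ≡ c₁ e₀) (sym same) (edge-color (suc n))

    colorClass-atLeast : ∀ {k} → GirthAtLeast G (2 * k ∸ 1) → ∀ e₀ → FiberAtLeast k c₁ e₀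
    colorClass-atLeast {k} girth e₀ = even-edge , even-edge-injective , even-edge-color
      where
      open Alternating e₀
      open Walk walk

      even-edge : Fin k → E G
      even-edge i = edge (toℕ i * 2)

      even-edge-injective : Injective _≡_ _≡_ even-edge
      even-edge-injective {i} {j} same = toℕ-injective (*-cancelʳ-≡ (toℕ i) (toℕ j) 2
        (edge-injective walk walk-non-backtracking girth
          (double<2*∸1 (toℕ<n i)) (double<2*∸1 (toℕ<n j)) same))

      even-edge-color : ∀ i → c₁ (even-edge i) ≡ c₁ e₀
      even-edge-color i = subst (λ b → coloring b (even-edge i) ≡ c₁ e₀)
                                (parity-even (toℕ i)) (edge-color (toℕ i * 2))

theorem3p3 : (k : ℕ) → 2 ≤ k → (G : Graph) → Bridgeless G
    → GirthAtLeast G (2 * k ∸ 1) → SimColorable G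
    → ∀ χ' → IsChromaticIndex G χ' → k * χ' ≤ numEdges G
theorem3p3 k _ G _ girth (l , S) χ' (_ , minimal) = begin
  k * χ'            ≤⟨ *-monoʳ-≤ k (minimal _ (index-in-image , proper)) ⟩
  k * length image  ≡⟨ *-comm k _ ⟩
  length image * k  ≤⟨ ∣image∣*k≤m (colorClass-atLeast G S girth) ⟩
  numEdges G        ∎
  where
  open SimColoring S
  open Image Fin._≟_ c₁
  open ≤-Reasoning

  proper : Proper G index-in-image
  proper e e' e≢e' shared = proper₁ e e' e≢e' shared ∘ index-in-image-reflects
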